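{- Let $u$ be a node of a union-product circuit satisfying the conditions below. Then there is a bijection between the set of visiting trees of $u$ and the set $\Upsilon(u)$ such that, for each visiting tree $S$ and its corresponding matching $M\in\Upsilon(u)$, the set of edges stored in the leaves of $S$ is exactly $M$.
   Context: Let $G^\star$ be a graph. A union-product circuit is a finite directed acyclic graph whose sinks (leaves) each store an edge of $G^\star$, and whose every other node is either a union node or a product node with exactly two children, a left child $l$ and a right child $r$. For sets $X,Y$ of matchings, $X\,\square\,Y=\{M_X\cup M_Y: M_X\in X,\ M_Y\in Y\}$. Define $\Upsilon$ recursively: for a leaf storing $e$, $\Upsilon=\{\{e\}\}$; for a union node, $\Upsilon(u)=\Upsilon(l)\cup\Upsilon(r)$; for a product node, $\Upsilon(u)=\Upsilon(l)\,\square\,\Upsilon(r)$. The circuit is assumed to satisfy, for every node $u$ with children $l,r$: every element of $\Upsilon(u)$ is a matching of $G^\star$; if $u$ is a union node then $\Upsilon(l)\cap\Upsilon(r)=\emptyset$; if $u$ is a product node then $\bigcup_{M\in\Upsilon(l)}M$ and $\bigcup_{M\in\Upsilon(r)}M$ are disjoint. Visiting trees are defined recursively: a leaf $u$ has exactly one visiting tree, the single node $u$; the visiting trees of a union node $u$ are the visiting trees of $l$ together with the visiting trees of $r$ (a choice of exactly one child, so this is a disjoint union of the two families); a visiting tree of a product node $u$ is a rooted binary tree with root $u$ whose left subtree is a visiting tree of $l$ and whose right subtree is a visiting tree of $r$. The leaves of a visiting tree are leaves of the circuit and hence store edges of $G^\star$. -}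

module Defs where

open import Level using (0ℓ)
open import Data.Nat using (ℕ)
open import Data.Fin using (Fin; _<_)
open import Data.Fin.Subset using (Subset; ⁅_⁆; _∪_; _∈_)
open import Data.Product using (Σ; proj₁; _×_)
open import Data.Empty using (⊥)
open import Relation.Nullary using (¬_)
open import Relation.Binary.PropositionalEquality
  using (_≡_; _≢_; isEquivalence)
open import Relation.Binary.Bundles using (Setoid)
import Relation.Binary.Construct.On as On

record Graph : Set where
  field
    nV   : ℕ
    nE   : ℕ
    end₁ : Fin nE → Fin nV
    end₂ : Fin nE → Fin nV
    loopless : ∀ e → end₁ e ≢ end₂ e
    simple   : ∀ e f → end₁ e ≡ end₁ f → end₂ e ≡ end₂ f → e ≡ f
    simple'  : ∀ e f → end₁ e ≡ end₂ f → end₂ e ≡ end₁ f → e ≡ f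

  Incident : Fin nE → Fin nE → Set
  Incident e f =
    (end₁ e ≡ end₁ f) ⊎' (end₁ e ≡ end₂ f) ⊎' (end₂ e ≡ end₁ f) ⊎' (end₂ e ≡ end₂ f)
    where open import Data.Sum renaming (_⊎_ to _⊎'_)

  IsMatching : Subset nE → Set
  IsMatching M = ∀ e f → e ∈ M → f ∈ M → e ≢ f → ¬ Incident e f

data Node (N m : ℕ) : Set where
  leaf    : Fin m → Node N m
  union   : (l r : Fin N) → Node N m
  product : (l r : Fin N) → Node N m

record Circuit (G : Graph) : Set where
  field
    size : ℕ
    node : Fin size → Node size (Graph.nE G)

module _ {G : Graph} (C : Circuit G) where
  open Graph G
  open Circuit C

  -- acyclicity, via a topological numbering: children have smaller index
  Acyclic : Set
  Acyclic = ∀ u l r → (node u ≡ union l r → l < u × r < u)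
                    × (node u ≡ product l r → l < u × r < u)

  data _∈Υ_ : Subset nE → Fin size → Set where
    leafΥ   : ∀ {u e} → node u ≡ leaf e → ⁅ e ⁆ ∈Υ u
    unionˡΥ : ∀ {u l r M} → node u ≡ union l r → M ∈Υ l → M ∈Υ u
    unionʳΥ : ∀ {u l r M} → node u ≡ union l r → M ∈Υ r → M ∈Υ u
    prodΥ   : ∀ {u l r X Y} → node u ≡ product l r →
              X ∈Υ l → Y ∈Υ r → (X ∪ Y) ∈Υ u

  record WellFormed : Set where
    field
      acyclic  : Acyclic
      matching : ∀ u M → M ∈Υ u → IsMatching M
      unionDisjoint : ∀ u l r → node u ≡ union l r →
                      ∀ M → M ∈Υ l → M ∈Υ r → ⊥
      productDisjoint : ∀ u l r → node u ≡ product l r →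
                      ∀ X Y e → X ∈Υ l → Y ∈Υ r → e ∈ X → e ∈ Y → ⊥

  -- Υ(u) as a set: matchings M with M ∈ Υ(u), identified by M
  ΥSetoid : Fin size → Setoid 0ℓ 0ℓ
  ΥSetoid u = record
    { Carrier       = Σ (Subset nE) (λ M → M ∈Υ u)
    ; _≈_           = λ a b → proj₁ a ≡ proj₁ b
    ; isEquivalence = On.isEquivalence proj₁ isEquivalence
    }

  data VisitingTree : Fin size → Set where
    leafT   : ∀ {u e} → node u ≡ leaf e → VisitingTree u
    leftT   : ∀ {u l r} → node u ≡ union l r → VisitingTree l → VisitingTree u
    rightT  : ∀ {u l r} → node u ≡ union l r → VisitingTree r → VisitingTree u
    prodT   : ∀ {u l r} → node u ≡ product l r →
              VisitingTree l → VisitingTree r → VisitingTree u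

  leafEdges : ∀ {u} → VisitingTree u → Subset nE
  leafEdges (leafT {e = e} _) = ⁅ e ⁆
  leafEdges (leftT _ S)       = leafEdges S
  leafEdges (rightT _ S)      = leafEdges S
  leafEdges (prodT _ S T)     = leafEdges S ∪ leafEdges T

-- A visiting tree is a derivation of M ∈ Υ(u) with M forgotten, and its leaf edges
-- recover M; so reading off the leaf edges maps the visiting trees of u onto Υ(u).
-- The map is injective by the disjointness conditions: at a union node Υ(l) ∩ Υ(r) = ∅
-- forces two trees with the same edges to choose the same child, and at a product node
-- the edges on the two sides are disjoint, so a union X ∪ Y determines X and Y.
module Submission where

open import Defs
open import Axiom.UniquenessOfIdentityProofs using (module Decidable⇒UIP)
open import Data.Empty using (⊥; ⊥-elim)
open import Data.Fin as Fin using (Fin)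
open import Data.Fin.Subset using (Subset; _∪_; _∈_; _⊆_)
open import Data.Fin.Subset.Properties using (x∈p∪q⁻; x∈p∪q⁺; ⊆-antisym; ∪-comm)
open import Data.Nat using (ℕ)
open import Data.Product using (Σ; proj₁; _×_; _,_)
open import Data.Sum using (inj₁; inj₂)
open import Function.Bundles using (Bijection)
open import Relation.Binary.Definitions using (DecidableEquality)
open import Relation.Binary.PropositionalEquality
  using (_≡_; _≢_; refl; sym; trans; cong; cong₂; subst; setoid; module ≡-Reasoning)
open import Relation.Nullary using (no; map′; _×-dec_)

-- Visiting trees carry proofs of node u ≡ …; identifying trees needs these proofs to be
-- unique, which Hedberg's theorem gives from decidable equality of nodes.
module _ {N m : ℕ} where

  _≟-Node_ : DecidableEquality (Node N m)
  leaf a      ≟-Node leaf b      = map′ (cong leaf) (λ { refl → refl }) (a Fin.≟ b)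
  union a b   ≟-Node union c d   =
    map′ (λ { (refl , refl) → refl }) (λ { refl → refl , refl }) (a Fin.≟ c ×-dec b Fin.≟ d)
  product a b ≟-Node product c d =
    map′ (λ { (refl , refl) → refl }) (λ { refl → refl , refl }) (a Fin.≟ c ×-dec b Fin.≟ d)
  leaf _      ≟-Node union _ _   = no λ ()
  leaf _      ≟-Node product _ _ = no λ ()
  union _ _   ≟-Node leaf _      = no λ ()
  union _ _   ≟-Node product _ _ = no λ ()
  product _ _ ≟-Node leaf _      = no λ ()
  product _ _ ≟-Node union _ _   = no λ ()

  Node-≡-irrelevant : {x y : Node N m} (p q : x ≡ y) → p ≡ q
  Node-≡-irrelevant = Decidable⇒UIP.≡-irrelevant _≟-Node_

Disjoint : ∀ {n} → Subset n → Subset n → Set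
Disjoint p q = ∀ {x} → x ∈ p → x ∈ q → ⊥

∪≡∪⇒⊆ : ∀ {n} {X₁ Y₁ X₂ Y₂ : Subset n} → Disjoint X₁ Y₂ → X₁ ∪ Y₁ ≡ X₂ ∪ Y₂ → X₁ ⊆ X₂
∪≡∪⇒⊆ {X₂ = X₂} {Y₂} X₁∩Y₂=∅ eq x∈X₁ with x∈p∪q⁻ X₂ Y₂ (subst (_ ∈_) eq (x∈p∪q⁺ (inj₁ x∈X₁)))
... | inj₁ x∈X₂ = x∈X₂
... | inj₂ x∈Y₂ = ⊥-elim (X₁∩Y₂=∅ x∈X₁ x∈Y₂)

∪-cancel-disjoint : ∀ {n} {X₁ Y₁ X₂ Y₂ : Subset n} → Disjoint X₁ Y₂ → Disjoint X₂ Y₁ →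
                    X₁ ∪ Y₁ ≡ X₂ ∪ Y₂ → X₁ ≡ X₂ × Y₁ ≡ Y₂
∪-cancel-disjoint {X₁ = X₁} {Y₁} {X₂} {Y₂} X₁∩Y₂=∅ X₂∩Y₁=∅ eq =
  ⊆-antisym (∪≡∪⇒⊆ X₁∩Y₂=∅ eq) (∪≡∪⇒⊆ X₂∩Y₁=∅ (sym eq)) ,
  ⊆-antisym (∪≡∪⇒⊆ (λ y∈Y₁ y∈X₂ → X₂∩Y₁=∅ y∈X₂ y∈Y₁) eq′)
            (∪≡∪⇒⊆ (λ y∈Y₂ y∈X₁ → X₁∩Y₂=∅ y∈X₁ y∈Y₂) (sym eq′))
  where
  open ≡-Reasoning

  eq′ : Y₁ ∪ X₁ ≡ Y₂ ∪ X₂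
  eq′ = begin
    Y₁ ∪ X₁ ≡⟨ ∪-comm Y₁ X₁ ⟩
    X₁ ∪ Y₁ ≡⟨ eq ⟩
    X₂ ∪ Y₂ ≡⟨ ∪-comm X₂ Y₂ ⟩
    Y₂ ∪ X₂ ∎

module _ {G : Graph} (C : Circuit G) where
  open Circuit C using (node)

  leafEdges∈Υ : ∀ {u} (S : VisitingTree C u) → _∈Υ_ C (leafEdges C S) u
  leafEdges∈Υ (leafT p)     = leafΥ p
  leafEdges∈Υ (leftT p S)   = unionˡΥ p (leafEdges∈Υ S)
  leafEdges∈Υ (rightT p S)  = unionʳΥ p (leafEdges∈Υ S)
  leafEdges∈Υ (prodT p S T) = prodΥ p (leafEdges∈Υ S) (leafEdges∈Υ T)

  ∈Υ⇒visitingTree : ∀ {u M} → _∈Υ_ C M u → Σ (VisitingTree C u) (λ S → leafEdges C S ≡ M)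
  ∈Υ⇒visitingTree (leafΥ p) = leafT p , refl
  ∈Υ⇒visitingTree (unionˡΥ p M∈Υl) =
    let S , S↦M = ∈Υ⇒visitingTree M∈Υl in leftT p S , S↦M
  ∈Υ⇒visitingTree (unionʳΥ p M∈Υr) =
    let S , S↦M = ∈Υ⇒visitingTree M∈Υr in rightT p S , S↦M
  ∈Υ⇒visitingTree (prodΥ p X∈Υl Y∈Υr) =
    let S , S↦X = ∈Υ⇒visitingTree X∈Υl
        T , T↦Y = ∈Υ⇒visitingTree Y∈Υr
    in prodT p S T , cong₂ _∪_ S↦X T↦Y

  module _ (W : WellFormed C) where
    open WellFormed W using (unionDisjoint; productDisjoint)

    leafEdges-left≢right : ∀ {u l r} → node u ≡ union l r →
                           (S : VisitingTree C l) (T : VisitingTree C r) →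
                           leafEdges C S ≢ leafEdges C T
    leafEdges-left≢right p S T S≡T =
      unionDisjoint _ _ _ p _ (leafEdges∈Υ S) (subst (λ M → _∈Υ_ C M _) (sym S≡T) (leafEdges∈Υ T))

    leafEdges-disjoint : ∀ {u l r} → node u ≡ product l r →
                         (S : VisitingTree C l) (T : VisitingTree C r) →
                         Disjoint (leafEdges C S) (leafEdges C T)
    leafEdges-disjoint p S T = productDisjoint _ _ _ p _ _ _ (leafEdges∈Υ S) (leafEdges∈Υ T)

    leafEdges-injective : ∀ {u} (S T : VisitingTree C u) → leafEdges C S ≡ leafEdges C T → S ≡ T
    leafEdges-injective (leafT p) (leafT q) _ with refl ← trans (sym p) q =
      cong leafT (Node-≡-irrelevant p q)
    leafEdges-injective (leftT p S) (leftT q T) S≡T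
      with refl ← trans (sym p) q with refl ← Node-≡-irrelevant p q =
      cong (leftT p) (leafEdges-injective S T S≡T)
    leafEdges-injective (rightT p S) (rightT q T) S≡T
      with refl ← trans (sym p) q with refl ← Node-≡-irrelevant p q =
      cong (rightT p) (leafEdges-injective S T S≡T)
    leafEdges-injective (prodT p Sˡ Sʳ) (prodT q Tˡ Tʳ) S≡T
      with refl ← trans (sym p) q with refl ← Node-≡-irrelevant p q
      with Sˡ≡Tˡ , Sʳ≡Tʳ ← ∪-cancel-disjoint (leafEdges-disjoint p Sˡ Tʳ) (leafEdges-disjoint p Tˡ Sʳ) S≡T =
      cong₂ (prodT p) (leafEdges-injective Sˡ Tˡ Sˡ≡Tˡ) (leafEdges-injective Sʳ Tʳ Sʳ≡Tʳ)
    leafEdges-injective (leftT p S) (rightT q T) S≡T with refl ← trans (sym p) q =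
      ⊥-elim (leafEdges-left≢right p S T S≡T)
    leafEdges-injective (rightT p S) (leftT q T) S≡T with refl ← trans (sym p) q =
      ⊥-elim (leafEdges-left≢right p T S (sym S≡T))
    leafEdges-injective (leafT p)     (leftT q _)   _ with () ← trans (sym p) q
    leafEdges-injective (leafT p)     (rightT q _)  _ with () ← trans (sym p) q
    leafEdges-injective (leafT p)     (prodT q _ _) _ with () ← trans (sym p) q
    leafEdges-injective (leftT p _)   (leafT q)     _ with () ← trans (sym p) q
    leafEdges-injective (leftT p _)   (prodT q _ _) _ with () ← trans (sym p) q
    leafEdges-injective (rightT p _)  (leafT q)     _ with () ← trans (sym p) q
    leafEdges-injective (rightT p _)  (prodT q _ _) _ with () ← trans (sym p) q
    leafEdges-injective (prodT p _ _) (leafT q)     _ with () ← trans (sym p) q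
    leafEdges-injective (prodT p _ _) (leftT q _)   _ with () ← trans (sym p) q
    leafEdges-injective (prodT p _ _) (rightT q _)  _ with () ← trans (sym p) q

    leafEdges-bijection : ∀ u → Bijection (setoid (VisitingTree C u)) (ΥSetoid C u)
    leafEdges-bijection u = record
      { to        = λ S → leafEdges C S , leafEdges∈Υ S
      ; cong      = λ { refl → refl }
      ; bijective = leafEdges-injective _ _
                  , λ (M , M∈Υu) → let S , S↦M = ∈Υ⇒visitingTree M∈Υu in S , λ { refl → S↦M }
      }

lemma31 : (G : Graph) (C : Circuit G) → WellFormed C →
    (u : Fin (Circuit.size C)) →
    Σ (Bijection (setoid (VisitingTree C u)) (ΥSetoid C u))
    (λ f → ∀ S → proj₁ (Bijection.to f S) ≡ leafEdges C S)
lemma31 G C W u = leafEdges-bijection C W u , λ _ → refl
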